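{- For every i-formula $\Phi$ and every c-formula $F$ of QHC, $\vdash_{QHC}\ ?\Phi\to F$ holds if and only if $\vdash_{QHC}\ \Phi\to\,!F$ holds.
   Context: Meta-logical framework. Formulas of a first-order language may contain individual variables and predicate variables. Meta-formulas are built from formulas using meta-conjunction $\&$, meta-implication $\Rightarrow$, and universal meta-quantifiers over individual and predicate variables. A principle $\cdot G$, for a formula $G$, is the meta-formula obtained by universally meta-quantifying all free individual variables of $G$ and then all predicate variables of $G$. A rule $F_1,\dots,F_m/G$ is the meta-formula $\forall^2(\forall^1F_1\,\&\cdots\&\,\forall^1F_m\Rightarrow\forall^1G)$, where $\forall^1$ meta-quantifies the free individual variables of the formula it precedes and $\forall^2$ meta-quantifies all predicate variables occurring. A logic $L$ is given by a derivation system $\mathcal D$, a meta-conjunction of finitely many principles and rules. For a meta-formula $\mathcal F$, $\vdash_L\mathcal F$ means that $\mathcal D\Rightarrow\mathcal F$ is derivable by the natural-deduction meta-rules: introduction and elimination of $\&$, $\Rightarrow$ and the universal meta-quantifiers (elimination allows substituting terms for individual variables and formulas for predicate variables), plus $\alpha$-conversion. A formula by itself is a meta-formula, with its free variables not generalized. Language of QHC. It has individual variables and, for each $n\ge0$, countably many $n$-ary problem variables $\alpha,\beta,\gamma,\delta,\theta,\dots$ and countably many $n$-ary proper predicate variables $p,q,\dots$. - A c-formula is $\top$, $\bot$, an atom $p(x_1,\dots,x_n)$, or $?\Phi$ for an i-formula $\Phi$, closed under the classical connectives $\land,\lor,\to,\leftrightarrow,\neg$ and quantifiers $\exists,\forall$.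 - An i-formula is $\checkmark$ (triviality), $\curlywedge$ (absurdity), an atom $\alpha(x_1,\dots,x_n)$, or $!F$ for a c-formula $F$, closed under the intuitionistic connectives $\land,\lor,\to,\leftrightarrow,\neg$ (with $\neg\Phi:=\Phi\to\curlywedge$) and quantifiers $\exists,\forall$. Connectives applied to c-formulas are classical; those applied to i-formulas are intuitionistic. In particular, in $?\Phi\to F$ the implication is classical, and in $\Phi\to\,!F$ it is intuitionistic. QHC is the logic whose derivation system consists of: - (0a) all laws and rules of classical predicate logic QC, for c-formulas; - (0b) all laws and rules of intuitionistic predicate logic QH, for i-formulas; - the principles $\cdot\,?(\gamma\land\delta)\leftrightarrow ?\gamma\land ?\delta$, $\cdot\,?(\gamma\lor\delta)\leftrightarrow ?\gamma\lor ?\delta$, $\cdot\,?(\gamma\to\delta)\to(?\gamma\to ?\delta)$, $\cdot\,\neg ?\curlywedge$, $\cdot\,?\exists x\,\theta(x)\leftrightarrow\exists x\,?\theta(x)$, $\cdot\,?\forall x\,\theta(x)\to\forall x\,?\theta(x)$, $\cdot\,\gamma\to\,!?\gamma$, $\cdot\,\neg !\bot$, $\cdot\,?!p\to p$, $\cdot\,!p\to\,!?!p$ and $\cdot\,!(p\to q)\to(!p\to !q)$; - the rules $!p/p$ and $p/!p$. -}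

module Defs where

open import Data.Nat using (ℕ; zero; suc)
open import Data.Vec using (Vec; map)

-- Syntax of QHC (de Bruijn indices for individual variables;
-- the only terms are individual variables).

Term : Set
Term = ℕ

infixr 6 _∧ᶜ_ _∧ⁱ_
infixr 5 _∨ᶜ_ _∨ⁱ_
infixr 4 _⇒ᶜ_ _⇒ⁱ_ _⇔ᶜ_ _⇔ⁱ_
infix 2 ⊢ᶜ_ ⊢ⁱ_
infix 8 ⁇_ ‼_ ¬ᶜ_ ¬ⁱ_

mutual
  data CForm : Set where
    ⊤ᶜ ⊥ᶜ  : CForm
    patom  : (n : ℕ) → ℕ → Vec Term n → CForm   -- k-th n-ary proper predicate variable p
    ⁇_     : IForm → CForm
    _∧ᶜ_ _∨ᶜ_ _⇒ᶜ_ : CForm → CForm → CForm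
    ∃ᶜ ∀ᶜ  : CForm → CForm                       -- binds de Bruijn index 0

  data IForm : Set where
    ✓ ⋏    : IForm
    αatom  : (n : ℕ) → ℕ → Vec Term n → IForm   -- k-th n-ary problem variable α
    ‼_     : CForm → IForm
    _∧ⁱ_ _∨ⁱ_ _⇒ⁱ_ : IForm → IForm → IForm
    ∃ⁱ ∀ⁱ  : IForm → IForm

¬ᶜ_ : CForm → CForm
¬ᶜ A = A ⇒ᶜ ⊥ᶜ

¬ⁱ_ : IForm → IForm
¬ⁱ A = A ⇒ⁱ ⋏

_⇔ᶜ_ : CForm → CForm → CForm
A ⇔ᶜ B = (A ⇒ᶜ B) ∧ᶜ (B ⇒ᶜ A)

_⇔ⁱ_ : IForm → IForm → IForm
A ⇔ⁱ B = (A ⇒ⁱ B) ∧ⁱ (B ⇒ⁱ A)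

-- Renaming of individual variables (terms are variables, so substitution
-- of a term for a variable is a renaming).

lift : (ℕ → ℕ) → ℕ → ℕ
lift ρ zero    = zero
lift ρ (suc k) = suc (ρ k)

mutual
  renC : (ℕ → ℕ) → CForm → CForm
  renC ρ ⊤ᶜ = ⊤ᶜ
  renC ρ ⊥ᶜ = ⊥ᶜ
  renC ρ (patom n k xs) = patom n k (map ρ xs)
  renC ρ (⁇ Φ) = ⁇ (renI ρ Φ)
  renC ρ (A ∧ᶜ B) = renC ρ A ∧ᶜ renC ρ B
  renC ρ (A ∨ᶜ B) = renC ρ A ∨ᶜ renC ρ B
  renC ρ (A ⇒ᶜ B) = renC ρ A ⇒ᶜ renC ρ B
  renC ρ (∃ᶜ A) = ∃ᶜ (renC (lift ρ) A)
  renC ρ (∀ᶜ A) = ∀ᶜ (renC (lift ρ) A)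

  renI : (ℕ → ℕ) → IForm → IForm
  renI ρ ✓ = ✓
  renI ρ ⋏ = ⋏
  renI ρ (αatom n k xs) = αatom n k (map ρ xs)
  renI ρ (‼ F) = ‼ (renC ρ F)
  renI ρ (A ∧ⁱ B) = renI ρ A ∧ⁱ renI ρ B
  renI ρ (A ∨ⁱ B) = renI ρ A ∨ⁱ renI ρ B
  renI ρ (A ⇒ⁱ B) = renI ρ A ⇒ⁱ renI ρ B
  renI ρ (∃ⁱ A) = ∃ⁱ (renI (lift ρ) A)
  renI ρ (∀ⁱ A) = ∀ⁱ (renI (lift ρ) A)

inst : Term → ℕ → ℕ
inst t zero    = t
inst t (suc k) = k

_[_]ᶜ : CForm → Term → CForm
A [ t ]ᶜ = renC (inst t) A

_[_]ⁱ : IForm → Term → IForm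
A [ t ]ⁱ = renI (inst t) A

-- weakening (x not free in B)
shC : CForm → CForm
shC = renC suc

shI : IForm → IForm
shI = renI suc

-- Theorems of QHC, as the closure of a Hilbert-style calculus:
-- (0a) QC for c-formulas, (0b) QH for i-formulas, all substitution
-- instances of the listed principles, and the rules !p/p, p/!p.

mutual
  data ⊢ᶜ_ : CForm → Set where
    c-K    : ∀ A B → ⊢ᶜ A ⇒ᶜ (B ⇒ᶜ A)
    c-S    : ∀ A B C → ⊢ᶜ (A ⇒ᶜ (B ⇒ᶜ C)) ⇒ᶜ ((A ⇒ᶜ B) ⇒ᶜ (A ⇒ᶜ C))
    c-∧I   : ∀ A B → ⊢ᶜ A ⇒ᶜ (B ⇒ᶜ (A ∧ᶜ B))
    c-∧E₁  : ∀ A B → ⊢ᶜ (A ∧ᶜ B) ⇒ᶜ A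
    c-∧E₂  : ∀ A B → ⊢ᶜ (A ∧ᶜ B) ⇒ᶜ B
    c-∨I₁  : ∀ A B → ⊢ᶜ A ⇒ᶜ (A ∨ᶜ B)
    c-∨I₂  : ∀ A B → ⊢ᶜ B ⇒ᶜ (A ∨ᶜ B)
    c-∨E   : ∀ A B C → ⊢ᶜ (A ⇒ᶜ C) ⇒ᶜ ((B ⇒ᶜ C) ⇒ᶜ ((A ∨ᶜ B) ⇒ᶜ C))
    c-⊤I   : ⊢ᶜ ⊤ᶜ
    c-⊥E   : ∀ A → ⊢ᶜ ⊥ᶜ ⇒ᶜ A
    c-DNE  : ∀ A → ⊢ᶜ (¬ᶜ ¬ᶜ A) ⇒ᶜ A
    c-∀E   : ∀ A t → ⊢ᶜ ∀ᶜ A ⇒ᶜ (A [ t ]ᶜ)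
    c-∃I   : ∀ A t → ⊢ᶜ (A [ t ]ᶜ) ⇒ᶜ ∃ᶜ A
    c-MP   : ∀ {A B} → ⊢ᶜ A ⇒ᶜ B → ⊢ᶜ A → ⊢ᶜ B
    c-∀I   : ∀ {A B} → ⊢ᶜ shC B ⇒ᶜ A → ⊢ᶜ B ⇒ᶜ ∀ᶜ A
    c-∃E   : ∀ {A B} → ⊢ᶜ A ⇒ᶜ shC B → ⊢ᶜ ∃ᶜ A ⇒ᶜ B
    ax-?∧  : ∀ γ δ → ⊢ᶜ ⁇ (γ ∧ⁱ δ) ⇔ᶜ (⁇ γ ∧ᶜ ⁇ δ)
    ax-?∨  : ∀ γ δ → ⊢ᶜ ⁇ (γ ∨ⁱ δ) ⇔ᶜ (⁇ γ ∨ᶜ ⁇ δ)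
    ax-?→  : ∀ γ δ → ⊢ᶜ ⁇ (γ ⇒ⁱ δ) ⇒ᶜ (⁇ γ ⇒ᶜ ⁇ δ)
    ax-¬?⋏ : ⊢ᶜ ¬ᶜ (⁇ ⋏)
    ax-?∃  : ∀ θ → ⊢ᶜ ⁇ (∃ⁱ θ) ⇔ᶜ ∃ᶜ (⁇ θ)
    ax-?∀  : ∀ θ → ⊢ᶜ ⁇ (∀ⁱ θ) ⇒ᶜ ∀ᶜ (⁇ θ)
    ax-?!  : ∀ p → ⊢ᶜ ⁇ (‼ p) ⇒ᶜ p
    r-!p/p : ∀ {p} → ⊢ⁱ ‼ p → ⊢ᶜ p

  data ⊢ⁱ_ : IForm → Set where
    i-K    : ∀ A B → ⊢ⁱ A ⇒ⁱ (B ⇒ⁱ A)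
    i-S    : ∀ A B C → ⊢ⁱ (A ⇒ⁱ (B ⇒ⁱ C)) ⇒ⁱ ((A ⇒ⁱ B) ⇒ⁱ (A ⇒ⁱ C))
    i-∧I   : ∀ A B → ⊢ⁱ A ⇒ⁱ (B ⇒ⁱ (A ∧ⁱ B))
    i-∧E₁  : ∀ A B → ⊢ⁱ (A ∧ⁱ B) ⇒ⁱ A
    i-∧E₂  : ∀ A B → ⊢ⁱ (A ∧ⁱ B) ⇒ⁱ B
    i-∨I₁  : ∀ A B → ⊢ⁱ A ⇒ⁱ (A ∨ⁱ B)
    i-∨I₂  : ∀ A B → ⊢ⁱ B ⇒ⁱ (A ∨ⁱ B)
    i-∨E   : ∀ A B C → ⊢ⁱ (A ⇒ⁱ C) ⇒ⁱ ((B ⇒ⁱ C) ⇒ⁱ ((A ∨ⁱ B) ⇒ⁱ C))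
    i-✓I   : ⊢ⁱ ✓
    i-⋏E   : ∀ A → ⊢ⁱ ⋏ ⇒ⁱ A
    i-∀E   : ∀ A t → ⊢ⁱ ∀ⁱ A ⇒ⁱ (A [ t ]ⁱ)
    i-∃I   : ∀ A t → ⊢ⁱ (A [ t ]ⁱ) ⇒ⁱ ∃ⁱ A
    i-MP   : ∀ {A B} → ⊢ⁱ A ⇒ⁱ B → ⊢ⁱ A → ⊢ⁱ B
    i-∀I   : ∀ {A B} → ⊢ⁱ shI B ⇒ⁱ A → ⊢ⁱ B ⇒ⁱ ∀ⁱ A
    i-∃E   : ∀ {A B} → ⊢ⁱ A ⇒ⁱ shI B → ⊢ⁱ ∃ⁱ A ⇒ⁱ B
    ax-γ!? : ∀ γ → ⊢ⁱ γ ⇒ⁱ ‼ (⁇ γ)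
    ax-¬!⊥ : ⊢ⁱ ¬ⁱ (‼ ⊥ᶜ)
    ax-!!?! : ∀ p → ⊢ⁱ ‼ p ⇒ⁱ ‼ (⁇ (‼ p))
    ax-!K  : ∀ p q → ⊢ⁱ ‼ (p ⇒ᶜ q) ⇒ⁱ (‼ p ⇒ⁱ ‼ q)
    r-p/!p : ∀ {p} → ⊢ᶜ p → ⊢ⁱ ‼ p

-- ?Φ → F is transported to Φ → !?Φ → !F through γ → !?γ and the distribution of ! over
-- implication; conversely, Φ → !F yields ?(Φ → !F) by necessitation (γ → !?γ followed by
-- !p/p), which distributes to ?Φ → ?!F, and ?!F → F finishes.
module Submission where

open import Defs
open import Data.Product using (_×_; _,_)

⇒ⁱ-trans : ∀ {A B C} → ⊢ⁱ A ⇒ⁱ B → ⊢ⁱ B ⇒ⁱ C → ⊢ⁱ A ⇒ⁱ C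
⇒ⁱ-trans {A} {B} {C} ab bc = i-MP (i-MP (i-S A B C) (i-MP (i-K (B ⇒ⁱ C) A) bc)) ab

⇒ᶜ-trans : ∀ {A B C} → ⊢ᶜ A ⇒ᶜ B → ⊢ᶜ B ⇒ᶜ C → ⊢ᶜ A ⇒ᶜ C
⇒ᶜ-trans {A} {B} {C} ab bc = c-MP (c-MP (c-S A B C) (c-MP (c-K (B ⇒ᶜ C) A) bc)) ab

⁇-necessitation : ∀ {Φ} → ⊢ⁱ Φ → ⊢ᶜ ⁇ Φ
⁇-necessitation {Φ} d = r-!p/p (i-MP (ax-γ!? Φ) d)

‼-mono : ∀ {F G} → ⊢ᶜ F ⇒ᶜ G → ⊢ⁱ ‼ F ⇒ⁱ ‼ G
‼-mono {F} {G} d = i-MP (ax-!K F G) (r-p/!p d)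

⁇-mono : ∀ {Φ Ψ} → ⊢ⁱ Φ ⇒ⁱ Ψ → ⊢ᶜ ⁇ Φ ⇒ᶜ ⁇ Ψ
⁇-mono {Φ} {Ψ} d = c-MP (ax-?→ Φ Ψ) (⁇-necessitation d)

⁇⇒-to-⇒‼ : ∀ {Φ F} → ⊢ᶜ ⁇ Φ ⇒ᶜ F → ⊢ⁱ Φ ⇒ⁱ ‼ F
⁇⇒-to-⇒‼ {Φ} d = ⇒ⁱ-trans (ax-γ!? Φ) (‼-mono d)

⇒‼-to-⁇⇒ : ∀ {Φ F} → ⊢ⁱ Φ ⇒ⁱ ‼ F → ⊢ᶜ ⁇ Φ ⇒ᶜ F
⇒‼-to-⁇⇒ {F = F} d = ⇒ᶜ-trans (⁇-mono d) (ax-?! F)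

mainTheorem8 : (Φ : IForm) (F : CForm) →
    ((⊢ᶜ (⁇ Φ) ⇒ᶜ F) → (⊢ⁱ Φ ⇒ⁱ ‼ F)) × ((⊢ⁱ Φ ⇒ⁱ ‼ F) → (⊢ᶜ (⁇ Φ) ⇒ᶜ F))
mainTheorem8 Φ F = ⁇⇒-to-⇒‼ , ⇒‼-to-⁇⇒
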